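{- For every integer $d\ge 0$ and every integer $a\ge\max(2,2d-1)$, there exists a constructible $6$-labeled graph $H_{d,a}$ in which half of the vertices have label $1$ and half have label $2$, such that (i) $|V(H_{d,a})|\le 8a^d-6$, and (ii) for every partial orientation $\vec{G}$ of $H_{d,a}$ of maximum outdegree less than $d$, there exist vertices $u$ and $v$ with labels $1$ and $2$ respectively, at distance exactly two in $H_{d,a}$, such that for every common neighbor $x$ of $u$ and $v$ we have $(u,x)\notin E(\vec{G})$ and $(v,x)\notin E(\vec{G})$.
   Context: All graphs are finite, simple and undirected. A $k$-labeled graph is a graph with each vertex assigned a label from $\{1,\dots,k\}$ (labels may repeat or be unused). The constructible $k$-labeled graphs are the smallest family closed under: (a) a single labeled vertex; (b) disjoint union of at least two constructible $k$-labeled graphs; (c) for some $i,j\in[k]$, changing all labels $i$ to $j$; (d) for some $i,j\in[k]$, adding all edges between vertices with label $i$ and vertices with label $j$. A partial orientation of a graph $G$ is a directed graph $\vec{G}$ on $V(G)$ whose arcs $(u,v)$ satisfy $uv\in E(G)$; the outdegree of a vertex is its number of out-arcs. -}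

module Defs where

open import Data.Nat using (ℕ; zero; suc; _+_; _<_)
open import Data.Fin using (Fin; zero; suc; splitAt; _≟_)
open import Data.Sum using (_⊎_; inj₁; inj₂)
open import Data.Bool using (Bool; true; false; _∧_; _∨_; not; if_then_else_)
open import Data.List using (List; map; allFin)
open import Data.Nat.ListAction using (sum)
open import Data.Product using (Σ; _×_; _,_)
open import Relation.Nullary.Decidable using (⌊_⌋)
open import Relation.Binary.PropositionalEquality using (_≡_; _≢_)

record LGraph (k n : ℕ) : Set where
  field
    adj   : Fin n → Fin n → Bool
    label : Fin n → Fin k
open LGraph public

-- Syntax of constructions of k-labeled graphs (clique-width expressions).
-- A term of type CExpr k n builds a k-labeled graph on n vertices.
data CExpr (k : ℕ) : ℕ → Set where
  vertex  : Fin k → CExpr k 1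
  -- (b) disjoint union (binary; iterating it gives unions of >= 2 graphs)
  union   : ∀ {m n} → CExpr k m → CExpr k n → CExpr k (m + n)
  relabel : ∀ {n} → Fin k → Fin k → CExpr k n → CExpr k n
  join    : ∀ {n} → Fin k → Fin k → CExpr k n → CExpr k n

eqF : ∀ {k} → Fin k → Fin k → Bool
eqF i j = ⌊ i ≟ j ⌋

⟦_⟧ : ∀ {k n} → CExpr k n → LGraph k n
⟦ vertex i ⟧ = record { adj = λ _ _ → false ; label = λ _ → i }
⟦ union {m} {n} e f ⟧ = record { adj = A ; label = L }
  where
  L : Fin (m + n) → _
  L v with splitAt m v
  ... | inj₁ x = label ⟦ e ⟧ x
  ... | inj₂ y = label ⟦ f ⟧ y
  A : Fin (m + n) → Fin (m + n) → Bool
  A u v with splitAt m u | splitAt m v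
  ... | inj₁ x | inj₁ y = adj ⟦ e ⟧ x y
  ... | inj₂ x | inj₂ y = adj ⟦ f ⟧ x y
  ... | inj₁ _ | inj₂ _ = false
  ... | inj₂ _ | inj₁ _ = false
⟦ relabel i j e ⟧ = record
  { adj = adj ⟦ e ⟧
  ; label = λ v → if eqF (label ⟦ e ⟧ v) i then j else label ⟦ e ⟧ v }
⟦ join i j e ⟧ = record
  { adj = λ u v → adj ⟦ e ⟧ u v ∨
                  (not (eqF u v) ∧
                   ((eqF (label ⟦ e ⟧ u) i ∧ eqF (label ⟦ e ⟧ v) j) ∨
                    (eqF (label ⟦ e ⟧ u) j ∧ eqF (label ⟦ e ⟧ v) i)))
  ; label = label ⟦ e ⟧ }

count : ∀ {n} → (Fin n → Bool) → ℕ
count {n} p = sum (map (λ v → if p v then 1 else 0) (allFin n))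

record PartialOrientation {k n : ℕ} (G : LGraph k n) : Set where
  field
    arc      : Fin n → Fin n → Bool
    arc-edge : ∀ u v → arc u v ≡ true → adj G u v ≡ true
open PartialOrientation public

outdeg : ∀ {k n} {G : LGraph k n} → PartialOrientation G → Fin n → ℕ
outdeg O u = count (arc O u)

MaxOutdegLt : ∀ {k n} {G : LGraph k n} → PartialOrientation G → ℕ → Set
MaxOutdegLt {n = n} O d = ∀ (u : Fin n) → outdeg O u < d

Dist2 : ∀ {k n} → LGraph k n → Fin n → Fin n → Set
Dist2 G u v = u ≢ v × adj G u v ≡ false × Σ _ (λ x → adj G u x ≡ true × adj G x v ≡ true)

{-# OPTIONS --safe #-}
-- H₀ is two isolated vertices labelled 1 and 2. H_{d+1} consists of a copies of H_d; each
-- copy gets a hub adjacent to its label-1 vertices and a hub adjacent to its label-2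
-- vertices, and two apexes are added, each adjacent to all hubs of one kind. Hubs take
-- the label of their neighbours, apexes the other label. (Labels 1 and 2 are the colours
-- zero and suc zero; the other four labels mark hubs and apexes while they are attached.)
-- Let an orientation have outdegree at most d. If in some copy every vertex has an arc to
-- its hub, the orientation restricted to that copy has outdegree below d, and induction
-- gives the pair inside the copy (hubs cannot be common neighbours of a 1-2 pair).
-- Otherwise every copy has a vertex with no arc to its hub; as a ≥ 2d + 1, more than d of
-- these have the same label, the apex for that label has an arc to at most d hubs, and
-- so for one of these copies the vertex and the apex are at distance two with the hub as
-- their only common neighbour, and neither has an arc to it.
module Submission where

open import Defs
open import Data.Nat using (ℕ; zero; suc; _+_; _*_; _∸_; _^_; _≤_; _<_; _⊔_; z≤n; s≤s; s≤s⁻¹; _<?_)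
open import Data.Nat.Properties
  using ( +-assoc; +-suc; +-identityʳ; +-mono-≤; +-monoˡ-≤; +-monoʳ-≤; +-cancelˡ-≤
        ; *-monoˡ-≤; *-monoʳ-≤; ≤-refl; ≤-reflexive; ≤-trans; <-≤-trans; <⇒≱; ≮⇒≥; n≮0
        ; m≤m+n; m≤n+m; m<m+n; n≤1+n; m≤n+m∸n; m≤m⊔n; m≤n⊔m; module ≤-Reasoning )
open import Data.Nat.ListAction using (sum)
open import Data.Nat.Tactic.RingSolver using (solve-∀)
open import Data.Fin as Fin using (Fin; zero; suc; _↑ˡ_; _↑ʳ_; splitAt; #_)
open import Data.Fin.Properties using (splitAt-↑ˡ; splitAt-↑ʳ; any?; all?; ¬∀⟶∃¬)
open import Data.Bool using (Bool; true; false; not; _∧_; _∨_; if_then_else_)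
open import Data.Bool.Properties
  using (∧-comm; ∨-comm; ∧-zeroʳ; ∧-identityʳ; ∨-identityʳ; not-¬; ¬-not)
  renaming (_≟_ to _≟ᵇ_)
open import Data.List using (tabulate)
open import Data.List.Properties using (map-tabulate)
open import Data.Product using (Σ; ∃-syntax; _×_; _,_; proj₁; proj₂; swap)
open import Data.Sum using (_⊎_; inj₁; inj₂)
open import Function using (_∘_; id)
open import Function.Bundles using (mk⇔)
open import Relation.Nullary using (yes; no; contradiction)
open import Relation.Nullary.Decidable using (isYes≗does; dec-true; dec-false; does-⇔; _×-dec_)
open import Relation.Binary.PropositionalEquality

indicator : Bool → ℕ
indicator b = if b then 1 else 0

tally : ∀ {n} → (Fin n → Bool) → ℕ
tally {zero}  p = 0
tally {suc n} p = indicator (p zero) + tally (p ∘ suc)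

count≡tally : ∀ {n} (p : Fin n → Bool) → count p ≡ tally p
count≡tally p = trans (cong sum (map-tabulate id (indicator ∘ p))) (sum-tabulate p)
  where
  sum-tabulate : ∀ {n} (p : Fin n → Bool) → sum (tabulate (indicator ∘ p)) ≡ tally p
  sum-tabulate {zero}  p = refl
  sum-tabulate {suc n} p = cong (indicator (p zero) +_) (sum-tabulate (p ∘ suc))

tally-cong : ∀ {n} {p q : Fin n → Bool} → (∀ x → p x ≡ q x) → tally p ≡ tally q
tally-cong {zero}  p≗q = refl
tally-cong {suc n} p≗q = cong₂ _+_ (cong indicator (p≗q zero)) (tally-cong (p≗q ∘ suc))

0<indicator : ∀ {b} → b ≡ true → 0 < indicator b
0<indicator refl = s≤s z≤n

indicator-mono : ∀ {a b} → (a ≡ true → b ≡ true) → indicator a ≤ indicator b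
indicator-mono {false} a⇒b = z≤n
indicator-mono {true}  a⇒b rewrite a⇒b refl = ≤-refl

tally-mono : ∀ {n} {p q : Fin n → Bool} → (∀ x → p x ≡ true → q x ≡ true) → tally p ≤ tally q
tally-mono {zero}  p⇒q = z≤n
tally-mono {suc n} p⇒q = +-mono-≤ (indicator-mono (p⇒q zero)) (tally-mono (p⇒q ∘ suc))

indicator≤tally : ∀ {n} (p : Fin n → Bool) x → indicator (p x) ≤ tally p
indicator≤tally p zero    = m≤m+n _ _
indicator≤tally p (suc x) = ≤-trans (indicator≤tally (p ∘ suc) x) (m≤n+m _ _)

tally-↑ : ∀ m {n} (p : Fin (m + n) → Bool) → tally p ≡ tally (p ∘ (_↑ˡ n)) + tally (p ∘ (m ↑ʳ_))
tally-↑ zero    p = refl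
tally-↑ (suc m) p =
  trans (cong (indicator (p zero) +_) (tally-↑ m (p ∘ suc))) (sym (+-assoc (indicator (p zero)) _ _))

tally-not : ∀ {n} (p : Fin n → Bool) → tally p + tally (not ∘ p) ≡ n
tally-not {zero}  p = refl
tally-not {suc n} p with p zero
... | true  = cong suc (tally-not (p ∘ suc))
... | false = trans (+-suc _ _) (cong suc (tally-not (p ∘ suc)))

tally<⇒∃ : ∀ {n} {p q : Fin n → Bool} → tally q < tally p → ∃[ x ] p x ≡ true × q x ≡ false
tally<⇒∃ {p = p} {q} q<p with any? (λ x → p x ≟ᵇ true ×-dec q x ≟ᵇ false)
... | yes found = found
... | no none = contradiction (tally-mono p⇒q) (<⇒≱ q<p)
  where
  p⇒q : ∀ x → p x ≡ true → q x ≡ true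
  p⇒q x px with q x in qx
  ... | true  = refl
  ... | false = contradiction (x , px , qx) none

all-true-row⊎false-in-every-row : ∀ {m n} (p : Fin m → Fin n → Bool) →
  (∃[ i ] ∀ y → p i y ≡ true) ⊎ (∀ i → ∃[ y ] p i y ≡ false)
all-true-row⊎false-in-every-row {n = n} p with any? (λ i → all? (λ y → p i y ≟ᵇ true))
... | yes row = inj₁ row
... | no ¬row = inj₂ λ i →
  let y , ¬py = ¬∀⟶∃¬ n _ (λ y → p i y ≟ᵇ true) (¬row ∘ (i ,_)) in y , ¬-not ¬py

↑ˡ≢↑ʳ : ∀ {m n} (x : Fin m) (y : Fin n) → x ↑ˡ n ≢ m ↑ʳ y
↑ˡ≢↑ʳ {m} {n} x y eq
  with () ← trans (sym (splitAt-↑ˡ m x n)) (trans (cong (splitAt m) eq) (splitAt-↑ʳ m n y))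

eqF-refl : ∀ {k} (i : Fin k) → eqF i i ≡ true
eqF-refl i = trans (isYes≗does (i Fin.≟ i)) (dec-true (i Fin.≟ i) refl)

eqF-≢ : ∀ {k} {i j : Fin k} → i ≢ j → eqF i j ≡ false
eqF-≢ {i = i} {j} i≢j = trans (isYes≗does (i Fin.≟ j)) (dec-false (i Fin.≟ j) i≢j)

eqF⇒≡ : ∀ {k} {i j : Fin k} → eqF i j ≡ true → i ≡ j
eqF⇒≡ {i = i} {j} eq with i Fin.≟ j
eqF⇒≡ eq | yes i≡j = i≡j
eqF⇒≡ () | no _

eqF-sym : ∀ {k} (i j : Fin k) → eqF i j ≡ eqF j i
eqF-sym i j = trans (isYes≗does (i Fin.≟ j))
  (trans (does-⇔ (mk⇔ sym sym) (i Fin.≟ j) (j Fin.≟ i)) (sym (isYes≗does (j Fin.≟ i))))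

data UnionView (m n : ℕ) : Fin (m + n) → Set where
  left  : (x : Fin m) → UnionView m n (x ↑ˡ n)
  right : (y : Fin n) → UnionView m n (m ↑ʳ y)

unionView : ∀ m n (z : Fin (m + n)) → UnionView m n z
unionView zero    n z       = right z
unionView (suc m) n zero    = left zero
unionView (suc m) n (suc z) with unionView m n z
... | left x  = left (suc x)
... | right y = right y

module Union {k m n} (e : CExpr k m) (f : CExpr k n) where

  label-↑ˡ : ∀ x → label ⟦ union e f ⟧ (x ↑ˡ n) ≡ label ⟦ e ⟧ x
  label-↑ˡ x rewrite splitAt-↑ˡ m x n = refl

  label-↑ʳ : ∀ y → label ⟦ union e f ⟧ (m ↑ʳ y) ≡ label ⟦ f ⟧ y
  label-↑ʳ y rewrite splitAt-↑ʳ m n y = refl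

  adj-↑ˡ-↑ˡ : ∀ x x′ → adj ⟦ union e f ⟧ (x ↑ˡ n) (x′ ↑ˡ n) ≡ adj ⟦ e ⟧ x x′
  adj-↑ˡ-↑ˡ x x′ rewrite splitAt-↑ˡ m x n | splitAt-↑ˡ m x′ n = refl

  adj-↑ʳ-↑ʳ : ∀ y y′ → adj ⟦ union e f ⟧ (m ↑ʳ y) (m ↑ʳ y′) ≡ adj ⟦ f ⟧ y y′
  adj-↑ʳ-↑ʳ y y′ rewrite splitAt-↑ʳ m n y | splitAt-↑ʳ m n y′ = refl

  adj-↑ˡ-↑ʳ : ∀ x y → adj ⟦ union e f ⟧ (x ↑ˡ n) (m ↑ʳ y) ≡ false
  adj-↑ˡ-↑ʳ x y rewrite splitAt-↑ˡ m x n | splitAt-↑ʳ m n y = refl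

  adj-↑ʳ-↑ˡ : ∀ y x → adj ⟦ union e f ⟧ (m ↑ʳ y) (x ↑ˡ n) ≡ false
  adj-↑ʳ-↑ˡ y x rewrite splitAt-↑ʳ m n y | splitAt-↑ˡ m x n = refl

  adj-sym : (∀ x x′ → adj ⟦ e ⟧ x x′ ≡ adj ⟦ e ⟧ x′ x) →
            (∀ y y′ → adj ⟦ f ⟧ y y′ ≡ adj ⟦ f ⟧ y′ y) →
    ∀ u v → adj ⟦ union e f ⟧ u v ≡ adj ⟦ union e f ⟧ v u
  adj-sym e-sym f-sym u v with unionView m n u | unionView m n v
  ... | left x  | left x′  = trans (adj-↑ˡ-↑ˡ x x′) (trans (e-sym x x′) (sym (adj-↑ˡ-↑ˡ x′ x)))
  ... | right y | right y′ = trans (adj-↑ʳ-↑ʳ y y′) (trans (f-sym y y′) (sym (adj-↑ʳ-↑ʳ y′ y)))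
  ... | left x  | right y  = trans (adj-↑ˡ-↑ʳ x y) (sym (adj-↑ʳ-↑ˡ y x))
  ... | right y | left x   = trans (adj-↑ʳ-↑ˡ y x) (sym (adj-↑ˡ-↑ʳ x y))

linked : ∀ {k} → Fin k → Fin k → Fin k → Fin k → Bool
linked i j ℓ ℓ′ = (eqF ℓ i ∧ eqF ℓ′ j) ∨ (eqF ℓ j ∧ eqF ℓ′ i)

linked-sym : ∀ {k} (i j ℓ ℓ′ : Fin k) → linked i j ℓ ℓ′ ≡ linked i j ℓ′ ℓ
linked-sym i j ℓ ℓ′ =
  trans (∨-comm (eqF ℓ i ∧ eqF ℓ′ j) _) (cong₂ _∨_ (∧-comm (eqF ℓ j) _) (∧-comm (eqF ℓ i) _))

adj-sym : ∀ {k n} (e : CExpr k n) u v → adj ⟦ e ⟧ u v ≡ adj ⟦ e ⟧ v u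
adj-sym (vertex _) u v = refl
adj-sym (union e f) = Union.adj-sym e f (adj-sym e) (adj-sym f)
adj-sym (relabel _ _ e) u v = adj-sym e u v
adj-sym (join i j e) u v =
  cong₂ _∨_ (adj-sym e u v)
            (cong₂ _∧_ (cong not (eqF-sym u v)) (linked-sym i j (label ⟦ e ⟧ u) (label ⟦ e ⟧ v)))

cone : ∀ {k n} → Fin k → Fin k → CExpr k n → CExpr k (n + 1)
cone i j e = join i j (union e (vertex j))

module Cone {k n} (i j : Fin k) (e : CExpr k n) where
  open Union e (vertex j)

  old : Fin n → Fin (n + 1)
  old x = x ↑ˡ 1

  new : Fin (n + 1)
  new = n ↑ʳ zero

  label-old : ∀ x → label ⟦ cone i j e ⟧ (old x) ≡ label ⟦ e ⟧ x
  label-old = label-↑ˡ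

  label-new : label ⟦ cone i j e ⟧ new ≡ j
  label-new = label-↑ʳ zero

  adj-old-old : ∀ {x y} → label ⟦ e ⟧ x ≢ j → label ⟦ e ⟧ y ≢ j →
    adj ⟦ cone i j e ⟧ (old x) (old y) ≡ adj ⟦ e ⟧ x y
  adj-old-old {x} {y} x≢j y≢j
    rewrite adj-↑ˡ-↑ˡ x y | label-↑ˡ x | label-↑ˡ y | eqF-≢ x≢j | eqF-≢ y≢j
          | ∧-zeroʳ (eqF (label ⟦ e ⟧ x) i) | ∧-zeroʳ (not (eqF (old x) (old y)))
    = ∨-identityʳ _

  adj-old-new : ∀ {x} → label ⟦ e ⟧ x ≢ j →
    adj ⟦ cone i j e ⟧ (old x) new ≡ eqF (label ⟦ e ⟧ x) i
  adj-old-new {x} x≢j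
    rewrite adj-↑ˡ-↑ʳ x zero | eqF-≢ (↑ˡ≢↑ʳ x (zero {0})) | label-↑ˡ x | label-↑ʳ zero
          | eqF-refl j | eqF-≢ x≢j
    = trans (∨-identityʳ _) (∧-identityʳ _)

data Colour : Set where
  first second : Colour

opposite : Colour → Colour
opposite first  = second
opposite second = first

double-cone : ∀ {k n} (attach fresh : Colour → Fin k) → CExpr k n → CExpr k ((n + 1) + 1)
double-cone attach fresh e = cone (attach second) (fresh second) (cone (attach first) (fresh first) e)

module DoubleCone {k n} (attach fresh : Colour → Fin k) (fresh-≢ : fresh first ≢ fresh second)
                  (e : CExpr k n) where
  private
    module C₁ = Cone (attach first) (fresh first) e
    module C₂ = Cone (attach second) (fresh second) (cone (attach first) (fresh first) e)
    D = ⟦ double-cone attach fresh e ⟧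

  old : Fin n → Fin ((n + 1) + 1)
  old = C₂.old ∘ C₁.old

  new : Colour → Fin ((n + 1) + 1)
  new first  = C₂.old C₁.new
  new second = C₂.new

  Fresh : Fin n → Set
  Fresh x = ∀ σ → label ⟦ e ⟧ x ≢ fresh σ

  label-old : ∀ x → label D (old x) ≡ label ⟦ e ⟧ x
  label-old x = trans (C₂.label-old (C₁.old x)) (C₁.label-old x)

  label-new : ∀ σ → label D (new σ) ≡ fresh σ
  label-new first  = trans (C₂.label-old C₁.new) C₁.label-new
  label-new second = C₂.label-new

  private
    fresh-old : ∀ {x} → Fresh x →
      label ⟦ cone (attach first) (fresh first) e ⟧ (C₁.old x) ≢ fresh second
    fresh-old {x} x-fresh = x-fresh second ∘ trans (sym (C₁.label-old x))

  adj-old-old : ∀ {x y} → Fresh x → Fresh y → adj D (old x) (old y) ≡ adj ⟦ e ⟧ x y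
  adj-old-old x-fresh y-fresh =
    trans (C₂.adj-old-old (fresh-old x-fresh) (fresh-old y-fresh))
          (C₁.adj-old-old (x-fresh first) (y-fresh first))

  adj-old-new : ∀ {x} → Fresh x → ∀ σ → adj D (old x) (new σ) ≡ eqF (label ⟦ e ⟧ x) (attach σ)
  adj-old-new x-fresh first =
    trans (C₂.adj-old-old (fresh-old x-fresh) (fresh-≢ ∘ trans (sym C₁.label-new)))
          (C₁.adj-old-new (x-fresh first))
  adj-old-new {x} x-fresh second =
    trans (C₂.adj-old-new (fresh-old x-fresh)) (cong (λ ℓ → eqF ℓ (attach second)) (C₁.label-old x))

  data View : Fin ((n + 1) + 1) → Set where
    old-view : ∀ x → View (old x)
    new-view : ∀ σ → View (new σ)

  view : ∀ z → View z
  view z with unionView (n + 1) 1 z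
  ... | right zero = new-view second
  ... | left w with unionView n 1 w
  ...   | left x     = old-view x
  ...   | right zero = new-view first

  tally-split : ∀ p → tally p ≡ (tally (p ∘ old) + indicator (p (new first))) + indicator (p (new second))
  tally-split p = trans (tally-↑ (n + 1) p)
    (cong₂ _+_ (trans (tally-↑ n (p ∘ C₂.old)) (cong (tally (p ∘ old) +_) (+-identityʳ _)))
               (+-identityʳ _))

  tally-old≤ : ∀ p → tally (p ∘ old) ≤ tally p
  tally-old≤ p = ≤-trans (≤-trans (m≤m+n _ _) (m≤m+n _ _)) (≤-reflexive (sym (tally-split p)))

  tally-old+new≤ : ∀ p σ → tally (p ∘ old) + indicator (p (new σ)) ≤ tally p
  tally-old+new≤ p σ = ≤-trans (split≥ σ) (≤-reflexive (sym (tally-split p)))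
    where
    split≥ : ∀ σ → tally (p ∘ old) + indicator (p (new σ))
                   ≤ (tally (p ∘ old) + indicator (p (new first))) + indicator (p (new second))
    split≥ first  = m≤m+n _ _
    split≥ second = +-monoˡ-≤ (indicator (p (new second))) (m≤m+n (tally (p ∘ old)) _)

copiesSize : ℕ → ℕ → ℕ
copiesSize zero    n = n
copiesSize (suc j) n = n + copiesSize j n

copiesSize≡ : ∀ j n → copiesSize j n ≡ suc j * n
copiesSize≡ zero    n = sym (+-identityʳ n)
copiesSize≡ (suc j) n = cong (n +_) (copiesSize≡ j n)

-- suc j disjoint copies.
copies : ∀ {k n} (j : ℕ) → CExpr k n → CExpr k (copiesSize j n)
copies zero    e = e
copies (suc j) e = union e (copies j e)

copy : ∀ {n} (j : ℕ) → Fin (suc j) → Fin n → Fin (copiesSize j n)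
copy     zero    zero    x = x
copy {n} (suc j) zero    x = x ↑ˡ copiesSize j n
copy {n} (suc j) (suc i) x = n ↑ʳ copy j i x

data CopiesView {n} (j : ℕ) : Fin (copiesSize j n) → Set where
  copy-view : ∀ i x → CopiesView j (copy j i x)

copiesView : ∀ {n} j z → CopiesView {n} j z
copiesView zero z = copy-view zero z
copiesView {n} (suc j) z with unionView n (copiesSize j n) z
... | left x = copy-view zero x
... | right y with copiesView j y
...   | copy-view i x = copy-view (suc i) x

module Copies {k n} (e : CExpr k n) where

  label-copy : ∀ j i x → label ⟦ copies j e ⟧ (copy j i x) ≡ label ⟦ e ⟧ x
  label-copy zero    zero    x = refl
  label-copy (suc j) zero    x = Union.label-↑ˡ e (copies j e) x
  label-copy (suc j) (suc i) x = trans (Union.label-↑ʳ e (copies j e) _) (label-copy j i x)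

  adj-copy : ∀ j i x y → adj ⟦ copies j e ⟧ (copy j i x) (copy j i y) ≡ adj ⟦ e ⟧ x y
  adj-copy zero    zero    x y = refl
  adj-copy (suc j) zero    x y = Union.adj-↑ˡ-↑ˡ e (copies j e) x y
  adj-copy (suc j) (suc i) x y = trans (Union.adj-↑ʳ-↑ʳ e (copies j e) _ _) (adj-copy j i x y)

  adj-copy⇒≡ : ∀ j i i′ {x y} → adj ⟦ copies j e ⟧ (copy j i x) (copy j i′ y) ≡ true → i ≡ i′
  adj-copy⇒≡ zero    zero    zero     _ = refl
  adj-copy⇒≡ (suc j) zero    zero     _ = refl
  adj-copy⇒≡ (suc j) zero    (suc i′) a = contradiction a (not-¬ (Union.adj-↑ˡ-↑ʳ e (copies j e) _ _))
  adj-copy⇒≡ (suc j) (suc i) zero     a = contradiction a (not-¬ (Union.adj-↑ʳ-↑ˡ e (copies j e) _ _))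
  adj-copy⇒≡ (suc j) (suc i) (suc i′) a =
    cong suc (adj-copy⇒≡ j i i′ (trans (sym (Union.adj-↑ʳ-↑ʳ e (copies j e) _ _)) a))

tally-copies : ∀ {n} j (p : Fin (copiesSize j n) → Bool) {c} → (∀ i → tally (p ∘ copy j i) ≡ c) →
  tally p ≡ suc j * c
tally-copies     zero    p each = trans (each zero) (sym (+-identityʳ _))
tally-copies {n} (suc j) p each =
  trans (tally-↑ n p) (cong₂ _+_ (each zero) (tally-copies j (p ∘ (n ↑ʳ_)) (each ∘ suc)))

tally-copy≤ : ∀ {n} j (p : Fin (copiesSize j n) → Bool) i → tally (p ∘ copy j i) ≤ tally p
tally-copy≤     zero    p zero    = ≤-refl
tally-copy≤ {n} (suc j) p zero    = ≤-trans (m≤m+n _ _) (≤-reflexive (sym (tally-↑ n p)))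
tally-copy≤ {n} (suc j) p (suc i) =
  ≤-trans (≤-trans (tally-copy≤ j (p ∘ (n ↑ʳ_)) i) (m≤n+m _ _)) (≤-reflexive (sym (tally-↑ n p)))

tally-across-copies≤ : ∀ {n} j (p : Fin (copiesSize j n) → Bool) (q : Fin (suc j) → Bool) →
  (∀ i → indicator (q i) ≤ tally (p ∘ copy j i)) → tally q ≤ tally p
tally-across-copies≤     zero    p q each = ≤-trans (≤-reflexive (+-identityʳ _)) (each zero)
tally-across-copies≤ {n} (suc j) p q each =
  ≤-trans (+-mono-≤ (each zero) (tally-across-copies≤ j (p ∘ (n ↑ʳ_)) (q ∘ suc) (each ∘ suc)))
          (≤-reflexive (sym (tally-↑ n p)))

colour : Colour → Fin 6
colour first  = zero
colour second = suc zero

hubLabel apexLabel : Colour → Fin 6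
hubLabel first   = # 2
hubLabel second  = # 3
apexLabel first  = # 4
apexLabel second = # 5

colour-injective : ∀ {σ τ} → colour σ ≡ colour τ → σ ≡ τ
colour-injective {first}  {first}  _ = refl
colour-injective {second} {second} _ = refl

colour≢hubLabel : ∀ c σ → colour c ≢ hubLabel σ
colour≢hubLabel first  first  ()
colour≢hubLabel first  second ()
colour≢hubLabel second first  ()
colour≢hubLabel second second ()

colour≢apexLabel : ∀ c σ → colour c ≢ apexLabel σ
colour≢apexLabel first  first  ()
colour≢apexLabel first  second ()
colour≢apexLabel second first  ()
colour≢apexLabel second second ()

hubLabel≢apexLabel : ∀ σ τ → hubLabel σ ≢ apexLabel τ
hubLabel≢apexLabel first  first  ()
hubLabel≢apexLabel first  second ()
hubLabel≢apexLabel second first  ()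
hubLabel≢apexLabel second second ()

colour-indicators : ∀ c σ →
  indicator (eqF (colour σ) (colour c)) + indicator (eqF (colour (opposite σ)) (colour c)) ≡ 1
colour-indicators first  first  = refl
colour-indicators first  second = refl
colour-indicators second first  = refl
colour-indicators second second = refl

has-colour : Colour → Colour → Bool
has-colour σ c = eqF (colour c) (colour σ)

has-second≡not-first : ∀ c → has-colour second c ≡ not (has-colour first c)
has-second≡not-first first  = refl
has-second≡not-first second = refl

majority-colour : ∀ {n d} (c : Fin n → Colour) → d + d < n → ∃[ σ ] d < tally (has-colour σ ∘ c)
majority-colour {n} {d} c enough with d <? tally (has-colour first ∘ c)
... | yes many = first , many
... | no few = second , +-cancelˡ-≤ d (suc d) _ (begin
    d + suc d                                            ≡⟨ +-suc d d ⟩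
    suc (d + d)                                          ≤⟨ enough ⟩
    n                                                    ≡⟨ sym partition ⟩
    tally (has-colour first ∘ c) + tally (has-colour second ∘ c) ≤⟨ +-monoˡ-≤ _ (≮⇒≥ few) ⟩
    d + tally (has-colour second ∘ c)                    ∎)
  where
  open ≤-Reasoning
  partition : tally (has-colour first ∘ c) + tally (has-colour second ∘ c) ≡ n
  partition = trans (cong (tally (has-colour first ∘ c) +_) (tally-cong (has-second≡not-first ∘ c)))
                    (tally-not (has-colour first ∘ c))

Bicoloured : ∀ {n} → LGraph 6 n → Set
Bicoloured {n} G = (v : Fin n) → ∃[ c ] label G v ≡ colour c

opposite-colours⇒≢ : ∀ {n} {G : LGraph 6 n} {u v} σ →
  label G u ≡ colour σ → label G v ≡ colour (opposite σ) → u ≢ v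
opposite-colours⇒≢ first  lu lv refl with () ← trans (sym lu) lv
opposite-colours⇒≢ second lu lv refl with () ← trans (sym lu) lv

Blocked : ∀ {k n} {G : LGraph k n} → PartialOrientation G → Fin n → Fin n → Set
Blocked {n = n} {G} O u v =
  Dist2 G u v ×
  ((x : Fin n) → adj G u x ≡ true → adj G v x ≡ true → (arc O u x ≡ false) × (arc O v x ≡ false))

BlockedPair : ∀ {n} {G : LGraph 6 n} → PartialOrientation G → Set
BlockedPair {n} {G} O =
  Σ (Fin n) λ u → Σ (Fin n) λ v → (label G u ≡ zero) × (label G v ≡ suc zero) × Blocked O u v

Good : ∀ {n} → LGraph 6 n → ℕ → Set
Good G d = (O : PartialOrientation G) → MaxOutdegLt O d → BlockedPair O

blocked-sym : ∀ {k n} (e : CExpr k n) {O : PartialOrientation ⟦ e ⟧} {u v} → Blocked O u v → Blocked O v u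
blocked-sym e {u = u} {v} ((u≢v , uv , x , ux , xv) , common) =
  (u≢v ∘ sym , trans (adj-sym e v u) uv , x , trans (adj-sym e v x) xv , trans (adj-sym e x u) ux) ,
  λ y vy uy → swap (common y uy vy)

blocked-pair : ∀ {n} (e : CExpr 6 n) {O : PartialOrientation ⟦ e ⟧} {u v} σ →
  label ⟦ e ⟧ u ≡ colour σ → label ⟦ e ⟧ v ≡ colour (opposite σ) → Blocked O u v → BlockedPair O
blocked-pair e {O} {u} {v} first  lu lv b = u , v , lu , lv , b
blocked-pair e {O} {u} {v} second lu lv b = v , u , lv , lu , blocked-sym e {O = O} {u} {v} b

hubs : ∀ {m} → CExpr 6 m → CExpr 6 ((m + 1) + 1)
hubs = double-cone colour hubLabel

recolour : Fin 6 → Fin 6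
recolour ℓ = relabelled (# 5) (# 0) (relabelled (# 4) (# 1) (relabelled (# 3) (# 1) (relabelled (# 2) (# 0) ℓ)))
  where
  relabelled : Fin 6 → Fin 6 → Fin 6 → Fin 6
  relabelled i j ℓ = if eqF ℓ i then j else ℓ

step : ∀ {m} (k : ℕ) → CExpr 6 m → CExpr 6 ((copiesSize k ((m + 1) + 1) + 1) + 1)
step k Y = relabel (# 5) (# 0) (relabel (# 4) (# 1) (relabel (# 3) (# 1) (relabel (# 2) (# 0)
  (double-cone hubLabel apexLabel (copies k (hubs Y))))))

recolour-colour : ∀ {ℓ} → ∃[ c ] ℓ ≡ colour c → recolour ℓ ≡ ℓ
recolour-colour (first  , refl) = refl
recolour-colour (second , refl) = refl

recolour-hubLabel : ∀ σ → recolour (hubLabel σ) ≡ colour σ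
recolour-hubLabel first  = refl
recolour-hubLabel second = refl

recolour-apexLabel : ∀ σ → recolour (apexLabel σ) ≡ colour (opposite σ)
recolour-apexLabel first  = refl
recolour-apexLabel second = refl

module Step (k : ℕ) {m} (Y : CExpr 6 m) (bicoloured : Bicoloured ⟦ Y ⟧) where
  private
    module G = DoubleCone colour hubLabel (λ ()) Y
    module K = Copies (hubs Y)
    module T = DoubleCone hubLabel apexLabel (λ ()) (copies k (hubs Y))

  N : ℕ
  N = (copiesSize k ((m + 1) + 1) + 1) + 1

  S : LGraph 6 N
  S = ⟦ step k Y ⟧

  inner : Fin (suc k) → Fin m → Fin N
  inner i y = T.old (copy k i (G.old y))

  hub : Fin (suc k) → Colour → Fin N
  hub i σ = T.old (copy k i (G.new σ))

  apex : Colour → Fin N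
  apex = T.new

  data StepView : Fin N → Set where
    inner-view : ∀ i y → StepView (inner i y)
    hub-view   : ∀ i σ → StepView (hub i σ)
    apex-view  : ∀ σ → StepView (apex σ)

  stepView : ∀ v → StepView v
  stepView v with T.view v
  ... | T.new-view σ = apex-view σ
  ... | T.old-view z with copiesView k z
  ...   | copy-view i x with G.view x
  ...     | G.old-view y = inner-view i y
  ...     | G.new-view σ = hub-view i σ

  private
    label-copy-inner : ∀ i y → label ⟦ copies k (hubs Y) ⟧ (copy k i (G.old y)) ≡ label ⟦ Y ⟧ y
    label-copy-inner i y = trans (K.label-copy k i _) (G.label-old y)

    label-copy-hub : ∀ i σ → label ⟦ copies k (hubs Y) ⟧ (copy k i (G.new σ)) ≡ hubLabel σ
    label-copy-hub i σ = trans (K.label-copy k i _) (G.label-new σ)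

    inner-fresh : ∀ y → G.Fresh y
    inner-fresh y σ with bicoloured y
    ... | c , lc = colour≢hubLabel c σ ∘ trans (sym lc)

    copy-fresh : ∀ i x → T.Fresh (copy k i x)
    copy-fresh i x τ with G.view x
    ... | G.old-view y with bicoloured y
    ...   | c , lc = colour≢apexLabel c τ ∘ trans (sym (trans (label-copy-inner i y) lc))
    copy-fresh i x τ | G.new-view σ = hubLabel≢apexLabel σ τ ∘ trans (sym (label-copy-hub i σ))

  label-inner : ∀ i y → label S (inner i y) ≡ label ⟦ Y ⟧ y
  label-inner i y =
    trans (cong recolour (trans (T.label-old _) (label-copy-inner i y))) (recolour-colour (bicoloured y))

  label-hub : ∀ i σ → label S (hub i σ) ≡ colour σ
  label-hub i σ = trans (cong recolour (trans (T.label-old _) (label-copy-hub i σ))) (recolour-hubLabel σ)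

  label-apex : ∀ σ → label S (apex σ) ≡ colour (opposite σ)
  label-apex σ = trans (cong recolour (T.label-new σ)) (recolour-apexLabel σ)

  step-bicoloured : Bicoloured S
  step-bicoloured v with stepView v
  ... | inner-view i y with bicoloured y
  ...   | c , lc = c , trans (label-inner i y) lc
  step-bicoloured v | hub-view i σ = σ , label-hub i σ
  step-bicoloured v | apex-view σ  = opposite σ , label-apex σ

  adj-inner-inner : ∀ i y y′ → adj S (inner i y) (inner i y′) ≡ adj ⟦ Y ⟧ y y′
  adj-inner-inner i y y′ = begin
    adj S (inner i y) (inner i y′)
      ≡⟨ T.adj-old-old (copy-fresh i (G.old y)) (copy-fresh i (G.old y′)) ⟩
    adj ⟦ copies k (hubs Y) ⟧ (copy k i (G.old y)) (copy k i (G.old y′))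
      ≡⟨ K.adj-copy k i _ _ ⟩
    adj ⟦ hubs Y ⟧ (G.old y) (G.old y′)
      ≡⟨ G.adj-old-old (inner-fresh y) (inner-fresh y′) ⟩
    adj ⟦ Y ⟧ y y′ ∎
    where open ≡-Reasoning

  adj-inner-hub : ∀ i y σ → adj S (inner i y) (hub i σ) ≡ eqF (label ⟦ Y ⟧ y) (colour σ)
  adj-inner-hub i y σ = begin
    adj S (inner i y) (hub i σ)
      ≡⟨ T.adj-old-old (copy-fresh i (G.old y)) (copy-fresh i (G.new σ)) ⟩
    adj ⟦ copies k (hubs Y) ⟧ (copy k i (G.old y)) (copy k i (G.new σ))
      ≡⟨ K.adj-copy k i _ _ ⟩
    adj ⟦ hubs Y ⟧ (G.old y) (G.new σ)
      ≡⟨ G.adj-old-new (inner-fresh y) σ ⟩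
    eqF (label ⟦ Y ⟧ y) (colour σ) ∎
    where open ≡-Reasoning

  adj-inner-apex : ∀ i y σ → adj S (inner i y) (apex σ) ≡ false
  adj-inner-apex i y σ =
    trans (T.adj-old-new (copy-fresh i (G.old y)) σ)
          (eqF-≢ (inner-fresh y σ ∘ trans (sym (label-copy-inner i y))))

  adj-hub-apex : ∀ i σ → adj S (hub i σ) (apex σ) ≡ true
  adj-hub-apex i σ = trans (T.adj-old-new (copy-fresh i (G.new σ)) σ)
    (trans (cong (λ ℓ → eqF ℓ (hubLabel σ)) (label-copy-hub i σ)) (eqF-refl (hubLabel σ)))

  adj-inner⇒same-copy : ∀ i j y x → adj S (inner i y) (T.old (copy k j x)) ≡ true → i ≡ j
  adj-inner⇒same-copy i j y x a =
    K.adj-copy⇒≡ k i j (trans (sym (T.adj-old-old (copy-fresh i (G.old y)) (copy-fresh j x))) a)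

  adj-inner-hub⇒ : ∀ i j y σ → adj S (inner i y) (hub j σ) ≡ true →
    i ≡ j × label ⟦ Y ⟧ y ≡ colour σ
  adj-inner-hub⇒ i j y σ a with adj-inner⇒same-copy i j y (G.new σ) a
  ... | refl = refl , eqF⇒≡ (trans (sym (adj-inner-hub i y σ)) a)

  tally-inner< : ∀ (p : Fin N → Bool) i σ → p (hub i σ) ≡ true → tally (p ∘ inner i) < tally p
  tally-inner< p i σ hit = begin-strict
    tally (p ∘ inner i)                          <⟨ m<m+n _ (0<indicator hit) ⟩
    tally (p ∘ inner i) + indicator (p (hub i σ)) ≤⟨ G.tally-old+new≤ (p ∘ T.old ∘ copy k i) σ ⟩
    tally (p ∘ T.old ∘ copy k i)                 ≤⟨ tally-copy≤ k (p ∘ T.old) i ⟩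
    tally (p ∘ T.old)                            ≤⟨ T.tally-old≤ p ⟩
    tally p                                      ∎
    where open ≤-Reasoning

  tally-hubs≤ : ∀ (p : Fin N → Bool) σ → tally (λ i → p (hub i σ)) ≤ tally p
  tally-hubs≤ p σ = ≤-trans (tally-across-copies≤ k (p ∘ T.old) _ hub≤copy) (T.tally-old≤ p)
    where
    hub≤copy : ∀ i → indicator (p (hub i σ)) ≤ tally (p ∘ T.old ∘ copy k i)
    hub≤copy i = indicator≤tally (p ∘ T.old ∘ copy k i) (G.new σ)

  tally-colour : ∀ c → let t = tally (λ y → eqF (label ⟦ Y ⟧ y) (colour c)) in
    tally (λ v → eqF (label S v) (colour c)) ≡ suc k * (t + 1) + 1
  tally-colour c = begin
    tally p
      ≡⟨ T.tally-split p ⟩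
    (tally (p ∘ T.old) + indicator (p (apex first))) + indicator (p (apex second))
      ≡⟨ +-assoc (tally (p ∘ T.old)) _ _ ⟩
    tally (p ∘ T.old) + (indicator (p (apex first)) + indicator (p (apex second)))
      ≡⟨ cong₂ _+_ (tally-copies k (p ∘ T.old) per-copy) apexes ⟩
    suc k * (tally q + 1) + 1 ∎
    where
    open ≡-Reasoning
    p : Fin N → Bool
    p v = eqF (label S v) (colour c)
    q : Fin m → Bool
    q y = eqF (label ⟦ Y ⟧ y) (colour c)
    apexes : indicator (p (apex first)) + indicator (p (apex second)) ≡ 1
    apexes rewrite label-apex first | label-apex second = colour-indicators c second
    hubs-of : ∀ i → indicator (p (hub i first)) + indicator (p (hub i second)) ≡ 1
    hubs-of i rewrite label-hub i first | label-hub i second = colour-indicators c first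
    per-copy : ∀ i → tally (p ∘ T.old ∘ copy k i) ≡ tally q + 1
    per-copy i = trans (G.tally-split (p ∘ T.old ∘ copy k i))
      (trans (+-assoc (tally (p ∘ inner i)) _ _)
             (cong₂ _+_ (tally-cong (λ y → cong (λ ℓ → eqF ℓ (colour c)) (label-inner i y))) (hubs-of i)))

  restrict : PartialOrientation S → Fin (suc k) → PartialOrientation ⟦ Y ⟧
  restrict O i = record
    { arc      = λ y y′ → arc O (inner i y) (inner i y′)
    ; arc-edge = λ y y′ a → trans (sym (adj-inner-inner i y y′)) (arc-edge O _ _ a)
    }

  colourOf : Fin m → Colour
  colourOf y = proj₁ (bicoloured y)

  own-hub-arc : PartialOrientation S → Fin (suc k) → Fin m → Bool
  own-hub-arc O i y = arc O (inner i y) (hub i (colourOf y))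

  restrict-bounded : ∀ {d} (O : PartialOrientation S) i → MaxOutdegLt O (suc d) →
    (∀ y → own-hub-arc O i y ≡ true) → MaxOutdegLt (restrict O i) d
  restrict-bounded O i bounded all-hit y = <-≤-trans restricted< (s≤s⁻¹ (bounded (inner i y)))
    where
    restricted< : outdeg (restrict O i) y < outdeg O (inner i y)
    restricted< = subst₂ _<_ (sym (count≡tally (arc (restrict O i) y))) (sym (count≡tally (arc O (inner i y))))
      (tally-inner< (arc O (inner i y)) i (colourOf y) (all-hit y))

  lift-blocked : ∀ (O : PartialOrientation S) i {u v} →
    label ⟦ Y ⟧ u ≡ zero → label ⟦ Y ⟧ v ≡ suc zero →
    Blocked (restrict O i) u v → Blocked O (inner i u) (inner i v)
  lift-blocked O i {u} {v} lu lv ((_ , uv , x , ux , xv) , common) =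
    ( opposite-colours⇒≢ {G = S} {inner i u} {inner i v} first
        (trans (label-inner i u) lu) (trans (label-inner i v) lv)
    , trans (adj-inner-inner i u v) uv
    , inner i x , trans (adj-inner-inner i u x) ux , trans (adj-inner-inner i x v) xv )
    , common′
    where
    common′ : ∀ z → adj S (inner i u) z ≡ true → adj S (inner i v) z ≡ true →
      (arc O (inner i u) z ≡ false) × (arc O (inner i v) z ≡ false)
    common′ z uz vz with stepView z
    ... | inner-view j y with adj-inner⇒same-copy i j u (G.old y) uz
    ...   | refl = common y (trans (sym (adj-inner-inner i u y)) uz) (trans (sym (adj-inner-inner i v y)) vz)
    common′ z uz vz | hub-view j σ =
      let _ , uσ = adj-inner-hub⇒ i j u σ uz
          _ , vσ = adj-inner-hub⇒ i j v σ vz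
      in contradiction (trans (sym lu) (trans uσ (trans (sym vσ) lv))) λ ()
    common′ z uz vz | apex-view σ = contradiction uz (not-¬ (adj-inner-apex i u σ))

  apex-blocked : ∀ (O : PartialOrientation S) i y σ → label ⟦ Y ⟧ y ≡ colour σ →
    arc O (inner i y) (hub i σ) ≡ false → arc O (apex σ) (hub i σ) ≡ false →
    Blocked O (inner i y) (apex σ)
  apex-blocked O i y σ ly inner-misses apex-misses =
    ( opposite-colours⇒≢ {G = S} {inner i y} {apex σ} σ (trans (label-inner i y) ly) (label-apex σ)
    , adj-inner-apex i y σ
    , hub i σ
    , trans (adj-inner-hub i y σ) (trans (cong (λ ℓ → eqF ℓ (colour σ)) ly) (eqF-refl _))
    , adj-hub-apex i σ )
    , common
    where
    common : ∀ z → adj S (inner i y) z ≡ true → adj S (apex σ) z ≡ true →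
      (arc O (inner i y) z ≡ false) × (arc O (apex σ) z ≡ false)
    common z yz az with stepView z
    ... | inner-view j y′ =
      contradiction (trans (adj-sym (step k Y) (inner j y′) (apex σ)) az) (not-¬ (adj-inner-apex j y′ σ))
    ... | apex-view τ     = contradiction yz (not-¬ (adj-inner-apex i y τ))
    ... | hub-view j τ with adj-inner-hub⇒ i j y τ yz
    ...   | refl , lτ with colour-injective {σ} {τ} (trans (sym ly) lτ)
    ...     | refl = inner-misses , apex-misses

  pair-from-full-copy : ∀ {d} (O : PartialOrientation S) i → MaxOutdegLt O (suc d) →
    (∀ y → own-hub-arc O i y ≡ true) → Good ⟦ Y ⟧ d → BlockedPair O
  pair-from-full-copy O i bounded all-hit good
    with u , v , lu , lv , b ← good (restrict O i) (restrict-bounded O i bounded all-hit) =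
    inner i u , inner i v , trans (label-inner i u) lu , trans (label-inner i v) lv , lift-blocked O i lu lv b

  hub-arcs≤ : ∀ {d} (O : PartialOrientation S) → MaxOutdegLt O (suc d) →
    ∀ v σ → tally (λ i → arc O v (hub i σ)) ≤ d
  hub-arcs≤ {d} O bounded v σ =
    ≤-trans (tally-hubs≤ (arc O v) σ) (s≤s⁻¹ (subst (_< suc d) (count≡tally (arc O v)) (bounded v)))

  pair-from-misses : ∀ {d} (O : PartialOrientation S) → MaxOutdegLt O (suc d) → d + d < suc k →
    (∀ i → ∃[ y ] own-hub-arc O i y ≡ false) → BlockedPair O
  pair-from-misses {d} O bounded enough misses
    with σ , majority ← majority-colour (λ i → colourOf (proj₁ (misses i))) enough
    with i , coloured-σ , apex-misses ←
           tally<⇒∃ (<-≤-trans (s≤s (hub-arcs≤ O bounded (apex σ) σ)) majority) =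
    blocked-pair (step k Y) {O} {inner i y} {apex σ} σ (trans (label-inner i y) ly) (label-apex σ)
      (apex-blocked O i y σ ly (subst (λ τ → arc O (inner i y) (hub i τ) ≡ false) cy (proj₂ (misses i)))
                    apex-misses)
    where
    y = proj₁ (misses i)
    cy : colourOf y ≡ σ
    cy = colour-injective (eqF⇒≡ coloured-σ)
    ly : label ⟦ Y ⟧ y ≡ colour σ
    ly = trans (proj₂ (bicoloured y)) (cong colour cy)

  step-good : ∀ {d} → d + d < suc k → Good ⟦ Y ⟧ d → Good S (suc d)
  step-good enough good O bounded with all-true-row⊎false-in-every-row (own-hub-arc O)
  ... | inj₁ (i , all-hit) = pair-from-full-copy O i bounded all-hit good
  ... | inj₂ misses        = pair-from-misses O bounded enough misses

module Tower (k : ℕ) where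

  size : ℕ → ℕ
  size zero    = 2
  size (suc d) = (copiesSize k ((size d + 1) + 1) + 1) + 1

  H : (d : ℕ) → CExpr 6 (size d)
  H zero    = union (vertex zero) (vertex (suc zero))
  H (suc d) = step k (H d)

  H-bicoloured : ∀ d → Bicoloured ⟦ H d ⟧
  H-bicoloured zero v with unionView 1 1 v
  ... | left  zero = first  , Union.label-↑ˡ (vertex zero) (vertex (suc zero)) zero
  ... | right zero = second , Union.label-↑ʳ (vertex zero) (vertex (suc zero)) zero
  H-bicoloured (suc d) = Step.step-bicoloured k (H d) (H-bicoloured d)

  H-good : ∀ d → d + d ≤ suc (suc k) → Good ⟦ H d ⟧ d
  H-good zero    _ O bounded = contradiction (bounded zero) n≮0
  H-good (suc d) d+d≤ = Step.step-good k (H d) (H-bicoloured d) enough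
    (H-good d (≤-trans (+-mono-≤ (n≤1+n d) (n≤1+n d)) d+d≤))
    where
    enough : d + d < suc k
    enough = subst (_≤ suc k) (+-suc d d) (s≤s⁻¹ d+d≤)

  H-colour-count : ∀ d c → tally (λ v → eqF (label ⟦ H d ⟧ v) (colour c)) * 2 ≡ size d
  H-colour-count zero    first  = refl
  H-colour-count zero    second = refl
  H-colour-count (suc d) c = begin
    tally (λ v → eqF (label ⟦ H (suc d) ⟧ v) (colour c)) * 2
      ≡⟨ cong (_* 2) (Step.tally-colour k (H d) (H-bicoloured d) c) ⟩
    (suc k * (t + 1) + 1) * 2
      ≡⟨ double k t ⟩
    (suc k * ((t * 2 + 1) + 1) + 1) + 1
      ≡⟨ cong (λ s → (suc k * ((s + 1) + 1) + 1) + 1) (H-colour-count d c) ⟩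
    (suc k * ((size d + 1) + 1) + 1) + 1
      ≡⟨ cong (λ s → (s + 1) + 1) (sym (copiesSize≡ k ((size d + 1) + 1))) ⟩
    size (suc d) ∎
    where
    open ≡-Reasoning
    t = tally (λ y → eqF (label ⟦ H d ⟧ y) (colour c))
    double : ∀ k t → (suc k * (t + 1) + 1) * 2 ≡ (suc k * ((t * 2 + 1) + 1) + 1) + 1
    double = solve-∀

  size-bound : 1 ≤ k → ∀ d → size d + 6 ≤ 8 * suc k ^ d
  size-bound _   zero    = ≤-refl
  size-bound k≥1 (suc d) = begin
    ((copiesSize k G + 1) + 1) + 6  ≡⟨ cong (λ s → ((s + 1) + 1) + 6) (copiesSize≡ k G) ⟩
    ((suc k * G + 1) + 1) + 6       ≡⟨ +8 k (size d) ⟩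
    suc k * G + 8                   ≤⟨ +-monoʳ-≤ (suc k * G) (*-monoˡ-≤ 4 (s≤s k≥1)) ⟩
    suc k * G + suc k * 4           ≡⟨ distrib k (size d) ⟩
    suc k * (size d + 6)            ≤⟨ *-monoʳ-≤ (suc k) (size-bound k≥1 d) ⟩
    suc k * (8 * suc k ^ d)         ≡⟨ swap8 (suc k) (suc k ^ d) ⟩
    8 * (suc k * suc k ^ d)         ∎
    where
    open ≤-Reasoning
    G = (size d + 1) + 1
    +8 : ∀ k n → ((suc k * ((n + 1) + 1) + 1) + 1) + 6 ≡ suc k * ((n + 1) + 1) + 8
    +8 = solve-∀
    distrib : ∀ k n → suc k * ((n + 1) + 1) + suc k * 4 ≡ suc k * (n + 6)
    distrib = solve-∀
    swap8 : ∀ a p → a * (8 * p) ≡ 8 * (a * p)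
    swap8 = solve-∀

lemma32 : (d a : ℕ) → 2 ⊔ (2 * d ∸ 1) ≤ a →
    Σ ℕ (λ n → Σ (CExpr 6 n) (λ H →
      (count (λ v → eqF (label ⟦ H ⟧ v) zero) * 2 ≡ n)
      × (count (λ v → eqF (label ⟦ H ⟧ v) (suc zero)) * 2 ≡ n)
      × (n + 6 ≤ 8 * a ^ d)
      × ((O : PartialOrientation ⟦ H ⟧) → MaxOutdegLt O d →
          Σ (Fin n) (λ u → Σ (Fin n) (λ v →
            (label ⟦ H ⟧ u ≡ zero) × (label ⟦ H ⟧ v ≡ suc zero)
            × Dist2 ⟦ H ⟧ u v
            × ((x : Fin n) → adj ⟦ H ⟧ u x ≡ true → adj ⟦ H ⟧ v x ≡ true →
                 (arc O u x ≡ false) × (arc O v x ≡ false)))))))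
lemma32 d zero          a≥ = contradiction (≤-trans (m≤m⊔n 2 (2 * d ∸ 1)) a≥) λ ()
lemma32 d (suc zero)    a≥ = contradiction (≤-trans (m≤m⊔n 2 (2 * d ∸ 1)) a≥) λ { (s≤s ()) }
lemma32 d (suc (suc k)) a≥ =
  size d , H d ,
  colour-count first , colour-count second ,
  size-bound (s≤s z≤n) d ,
  H-good d (subst (_≤ suc (suc (suc k))) (cong (d +_) (+-identityʳ d)) 2d≤a+1)
  where
  open Tower (suc k)
  colour-count : ∀ c → count (λ v → eqF (label ⟦ H d ⟧ v) (colour c)) * 2 ≡ size d
  colour-count c =
    trans (cong (_* 2) (count≡tally (λ v → eqF (label ⟦ H d ⟧ v) (colour c)))) (H-colour-count d c)
  2d≤a+1 : 2 * d ≤ suc (suc (suc k))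
  2d≤a+1 = ≤-trans (m≤n+m∸n (2 * d) 1) (s≤s (≤-trans (m≤n⊔m 2 (2 * d ∸ 1)) a≥))
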